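{- Let $3\le m\le n$ and let $c$ be an exact $(m+n+1)$-coloring of $[m]\times[n]$ with no rainbow solution to $x_1+x_2=x_3$ and with $|c(D_m)|=3$. If $(i,j)\in[m]\times[n]$ with $i<s_3$ and $j<s_3$, then $c((i,j))\in c(D_m)$.
   Context: $[m]\times[n]=\{(i,j)\in\mathbb{Z}^2:1\le i\le m,1\le j\le n\}$ with componentwise addition. An $r$-coloring is a map $c:[m]\times[n]\to\{1,\dots,r\}$, exact if surjective; a rainbow solution is a triple $\alpha,\beta,\gamma$ with $\alpha+\beta=\gamma$ and pairwise distinct colors. $D_m=\{(i,i):1\le i\le m\}$ is the main diagonal and $c(X)=\{c(x):x\in X\}$. Set $s_1=1$, $s_2=\min\{x: c((x,x))\ne c((1,1))\}$ and $s_3=\min\{x: c((x,x))\notin\{c((1,1)),c((s_2,s_2))\}\}$ (these exist since $|c(D_m)|=3$). -}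

module Defs where

open import Data.Nat using (ℕ; _+_; _≤_; _<_)
open import Data.Product using (_×_; ∃; ∃-syntax; _,_)
open import Data.Sum using (_⊎_)
open import Relation.Binary.PropositionalEquality using (_≡_; _≢_)

-- A coloring of [m]×[n] is a function c : ℕ → ℕ → ℕ; only its values on
-- grid points (i,j) with 1 ≤ i ≤ m, 1 ≤ j ≤ n matter.
Coloring : Set
Coloring = ℕ → ℕ → ℕ

InGrid : ℕ → ℕ → ℕ → ℕ → Set
InGrid m n i j = (1 ≤ i × i ≤ m) × (1 ≤ j × j ≤ n)

IsColoring : ℕ → ℕ → ℕ → Coloring → Set
IsColoring m n r c = ∀ i j → InGrid m n i j → 1 ≤ c i j × c i j ≤ r

IsExactColoring : ℕ → ℕ → ℕ → Coloring → Set
IsExactColoring m n r c =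
  IsColoring m n r c ×
  (∀ k → 1 ≤ k → k ≤ r → ∃[ i ] ∃[ j ] (InGrid m n i j × c i j ≡ k))

Distinct3 : ℕ → ℕ → ℕ → Set
Distinct3 a b d = a ≢ b × a ≢ d × b ≢ d

RainbowSolution : ℕ → ℕ → Coloring → Set
RainbowSolution m n c =
  ∃[ a₁ ] ∃[ a₂ ] ∃[ b₁ ] ∃[ b₂ ]
    (InGrid m n a₁ a₂ × InGrid m n b₁ b₂ × InGrid m n (a₁ + b₁) (a₂ + b₂) ×
     Distinct3 (c a₁ a₂) (c b₁ b₂) (c (a₁ + b₁) (a₂ + b₂)))

InDiagImage : ℕ → Coloring → ℕ → Set
InDiagImage m c k = ∃[ x ] ((1 ≤ x × x ≤ m) × c x x ≡ k)

DiagImageSize3 : ℕ → Coloring → Set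
DiagImageSize3 m c =
  ∃[ a ] ∃[ b ] ∃[ d ]
    (Distinct3 a b d × InDiagImage m c a × InDiagImage m c b × InDiagImage m c d ×
     (∀ k → InDiagImage m c k → (k ≡ a ⊎ k ≡ b ⊎ k ≡ d)))

IsS2 : ℕ → Coloring → ℕ → Set
IsS2 m c s₂ =
  (1 ≤ s₂ × s₂ ≤ m) × c s₂ s₂ ≢ c 1 1 ×
  (∀ x → 1 ≤ x → x < s₂ → c x x ≡ c 1 1)

IsS3 : ℕ → Coloring → ℕ → ℕ → Set
IsS3 m c s₂ s₃ =
  (1 ≤ s₃ × s₃ ≤ m) × c s₃ s₃ ≢ c 1 1 × c s₃ s₃ ≢ c s₂ s₂ ×
  (∀ x → 1 ≤ x → x < s₃ → (c x x ≡ c 1 1 ⊎ c x x ≡ c s₂ s₂))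

-- Call a colour off-diagonal if it is not in c(D_m), and group the grid into the
-- m + n − 1 lines x − y = const. If p and p + (t,t) both have off-diagonal colours, they
-- agree, as (t,t) has a diagonal colour and there is no rainbow solution. Hence every line
-- carries at most one off-diagonal colour, and since exactness provides m + n − 2
-- off-diagonal colours for the m + n − 2 off-diagonal lines, a count shows that every
-- off-diagonal line carries an off-diagonal colour and that each off-diagonal colour lives
-- on a single line.
-- Suppose (i,j) with i, j < s₃ had an off-diagonal colour. Its mirror image (u,w) through
-- (s₃,s₃) lies on an off-diagonal line; pick a point β of that line with an off-diagonal
-- colour. No rainbow on (i,j) + (u,w) = (s₃,s₃) gives c(u,w) ∈ {c(i,j), c(s₃,s₃)}. In the
-- first case β and (u,w) share a colour, so (i,j) lies on the line of (u,w), forcing i = j.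
-- In the second, since c(s₃,s₃) differs from all c(t,t) with t < s₃, β = (u,w) + (t,t) with
-- t ≥ s₃, and then (i,j) + (2u + t − s₃, 2w + t − s₃) = β is a rainbow solution.
module Submission where

open import Defs
open import Data.Nat using (ℕ; _+_; _≤_; _<_)
open import Data.Product using (_×_)
open import Relation.Nullary using (¬_)

open import Data.Nat using (suc; _∸_; _*_; z≤n; s≤s; z<s; _≟_; _<?_)
open import Data.Nat.Properties
open import Data.Nat.Tactic.RingSolver using (solve)
open import Data.List using (_∷_; [])
open import Data.Product using (_,_; proj₁; proj₂; ∃-syntax)
open import Data.Sum using (_⊎_; inj₁; inj₂; [_,_]′)
open import Data.Empty using (⊥; ⊥-elim)
open import Data.Fin using (Fin; toℕ; fromℕ<)
open import Data.Fin.Properties using (pigeonhole; toℕ<n; fromℕ<-injective)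
open import Function using (_∘_)
open import Relation.Binary using (tri<; tri≈; tri>)
open import Relation.Binary.PropositionalEquality
open import Relation.Nullary using (yes; no)
open import Relation.Nullary.Decidable using (decidable-stable)

-- x₁ − y₁ = x₂ − y₂, stated without subtraction.
SameLine : ℕ → ℕ → ℕ → ℕ → Set
SameLine x₁ y₁ x₂ y₂ = x₁ + y₂ ≡ x₂ + y₁

sameLine-trans : ∀ {x₁ y₁ x₂ y₂ x₃ y₃} →
  SameLine x₁ y₁ x₂ y₂ → SameLine x₂ y₂ x₃ y₃ → SameLine x₁ y₁ x₃ y₃
sameLine-trans {x₁} {y₁} {x₂} {y₂} {x₃} {y₃} l₁ l₂ = +-cancelʳ-≡ (x₂ + y₂) _ _ (begin
  x₁ + y₃ + (x₂ + y₂)     ≡⟨ solve (x₁ ∷ y₃ ∷ x₂ ∷ y₂ ∷ []) ⟩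
  (x₁ + y₂) + (x₂ + y₃)   ≡⟨ cong₂ _+_ l₁ l₂ ⟩
  (x₂ + y₁) + (x₃ + y₂)   ≡⟨ solve (x₂ ∷ y₁ ∷ x₃ ∷ y₂ ∷ []) ⟩
  x₃ + y₁ + (x₂ + y₂)     ∎)
  where open ≡-Reasoning

sameLine-shift : ∀ {x₁ y₁ x₂ y₂ t} → x₁ + t ≡ x₂ → SameLine x₁ y₁ x₂ y₂ → y₁ + t ≡ y₂
sameLine-shift {x₁} {y₁} {t = t} refl l =
  sym (+-cancelˡ-≡ x₁ _ _ (trans l (solve (x₁ ∷ t ∷ y₁ ∷ []))))

sameLine-+⇒≡ : ∀ {x y x′ y′ z z′} → x + x′ ≡ z → y + y′ ≡ z′ → SameLine z z′ x′ y′ → x ≡ y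
sameLine-+⇒≡ {x} {y} {x′} {y′} refl refl l = +-cancelʳ-≡ (x′ + y′) x y (begin
  x + (x′ + y′)     ≡⟨ solve (x ∷ x′ ∷ y′ ∷ []) ⟩
  x + x′ + y′       ≡⟨ l ⟩
  x′ + (y + y′)     ≡⟨ solve (x′ ∷ y ∷ y′ ∷ []) ⟩
  y + (x′ + y′)     ∎)
  where open ≡-Reasoning

-- In the next two lemmas i + u ≡ j + w says that (i,j) and (u,w) are mirror images
-- through a diagonal point.
reflection-sameLine⇒≡ : ∀ {i j u w} → i + u ≡ j + w → SameLine i j u w → i ≡ j
reflection-sameLine⇒≡ {i} {j} {u} {w} e l = *-cancelˡ-≡ i j 2 (+-cancelʳ-≡ (u + w) _ _ (begin
  2 * i + (u + w)       ≡⟨ solve (i ∷ u ∷ w ∷ []) ⟩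
  (i + u) + (i + w)     ≡⟨ cong₂ _+_ e l ⟩
  (j + w) + (u + j)     ≡⟨ solve (j ∷ u ∷ w ∷ []) ⟩
  2 * j + (u + w)       ∎))
  where open ≡-Reasoning

reflection-sameLine-double⇒≡ : ∀ {i j u w v} →
  i + u ≡ j + w → SameLine i j (u + u + v) (w + w + v) → i ≡ j
reflection-sameLine-double⇒≡ {i} {j} {u} {w} {v} e l =
  *-cancelˡ-≡ i j 3 (+-cancelʳ-≡ (u + u + w + w + v) _ _ (begin
    3 * i + (u + u + w + w + v)                 ≡⟨ solve (i ∷ u ∷ w ∷ v ∷ []) ⟩
    i + (w + w + v) + ((i + u) + (i + u))       ≡⟨ cong₂ _+_ l (cong₂ _+_ e e) ⟩
    (u + u + v) + j + ((j + w) + (j + w))       ≡⟨ solve (j ∷ u ∷ w ∷ v ∷ []) ⟩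
    3 * j + (u + u + w + w + v)                 ∎))
  where open ≡-Reasoning

doubledReflection : ∀ {i u v s b} → i + u ≡ s → u + (s + v) ≡ b → i + (u + u + v) ≡ b
doubledReflection {i} {u} {v} refl refl = solve (i ∷ u ∷ v ∷ [])

m<n⇒∃[o]m+o≡n : ∀ {m n} → m < n → ∃[ o ] (1 ≤ o × m + o ≡ n)
m<n⇒∃[o]m+o≡n {m} m<n with o , e ← m≤n⇒∃[o]m+o≡n m<n = suc o , s≤s z≤n , trans (+-suc m o) e

+-offset-≤ : ∀ {x t z k} → x + t ≡ z → z ≤ k → t ≤ k
+-offset-≤ {x} {t} e z≤k = ≤-trans (m≤n+m t x) (≤-trans (≤-reflexive e) z≤k)

-- The line through (x,y), as a number in [0, m+n) for grid points; n ∸ y is never truncated there.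
lineIndex : ℕ → ℕ → ℕ → ℕ
lineIndex n x y = x + (n ∸ y)

lineIndex+y≡x+n : ∀ n {x y} → y ≤ n → lineIndex n x y + y ≡ x + n
lineIndex+y≡x+n n {x} {y} y≤n = trans (+-assoc x (n ∸ y) y) (cong (x +_) (m∸n+n≡m {n} {y} y≤n))

sameLine-byOffset : ∀ {x₁ y₁ x₂ y₂ k ℓ} → ℓ + y₁ ≡ x₁ + k → ℓ + y₂ ≡ x₂ + k → SameLine x₁ y₁ x₂ y₂
sameLine-byOffset {x₁} {y₁} {x₂} {y₂} {k} {ℓ} e₁ e₂ = +-cancelʳ-≡ k _ _ (begin
  x₁ + y₂ + k       ≡⟨ solve (x₁ ∷ y₂ ∷ k ∷ []) ⟩
  (x₁ + k) + y₂     ≡⟨ cong (_+ y₂) (sym e₁) ⟩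
  (ℓ + y₁) + y₂     ≡⟨ solve (ℓ ∷ y₁ ∷ y₂ ∷ []) ⟩
  (ℓ + y₂) + y₁     ≡⟨ cong (_+ y₁) e₂ ⟩
  (x₂ + k) + y₁     ≡⟨ solve (x₂ ∷ y₁ ∷ k ∷ []) ⟩
  x₂ + y₁ + k       ∎)
  where open ≡-Reasoning

lineIndex-injective : ∀ n {x₁ y₁ x₂ y₂} → y₁ ≤ n → y₂ ≤ n →
  lineIndex n x₁ y₁ ≡ lineIndex n x₂ y₂ → SameLine x₁ y₁ x₂ y₂
lineIndex-injective n {x₁} {y₁} {x₂} {y₂} y₁≤n y₂≤n e =
  sameLine-byOffset {x₁} {y₁} {x₂} {y₂} {n} (lineIndex+y≡x+n n {x₁} y₁≤n)
    (trans (cong (_+ y₂) e) (lineIndex+y≡x+n n {x₂} y₂≤n))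

lineIndex<m+n : ∀ {m n x y} → x ≤ m → 1 ≤ y → y ≤ n → lineIndex n x y < m + n
lineIndex<m+n {n = suc n} {y = suc y} x≤m _ _ = +-mono-≤-< x≤m (s≤s (m∸n≤m n y))

¬sameLine-0n : ∀ {m n p q} → InGrid m n p q → ¬ SameLine 0 n p q
¬sameLine-0n {n = n} ((1≤p , _) , (_ , q≤n)) l = <-irrefl l (≤-<-trans q≤n (m<n+m n 1≤p))

inGrid-summand : ∀ {m n x y x′ y′ z z′} → x + x′ ≡ z → y + y′ ≡ z′ →
  InGrid m n z z′ → 1 ≤ x′ → 1 ≤ y′ → InGrid m n x′ y′
inGrid-summand ex ey ((_ , z≤m) , (_ , z′≤n)) 1≤x′ 1≤y′ =
  (1≤x′ , +-offset-≤ ex z≤m) , (1≤y′ , +-offset-≤ ey z′≤n)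

module _ {m n : ℕ} (m≤n : m ≤ n) {c : Coloring} (noRainbow : ¬ RainbowSolution m n c) where

  OffDiagonal : ℕ → Set
  OffDiagonal k = ¬ InDiagImage m c k

  diagonal-inGrid : ∀ {t} → 1 ≤ t → t ≤ m → InGrid m n t t
  diagonal-inGrid 1≤t t≤m = (1≤t , t≤m) , (1≤t , ≤-trans t≤m m≤n)

  diagonalColour : ∀ {t} → 1 ≤ t → t ≤ m → InDiagImage m c (c t t)
  diagonalColour {t} 1≤t t≤m = t , (1≤t , t≤m) , refl

  offDiagonal≢diagonal : ∀ {k k′} → OffDiagonal k → InDiagImage m c k′ → k ≢ k′
  offDiagonal≢diagonal o d refl = o d

  offDiagonal⇒≢ : ∀ {x y} → InGrid m n x y → OffDiagonal (c x y) → x ≢ y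
  offDiagonal⇒≢ {x} (gx , _) o refl = o (x , gx , refl)

  noRainbowSum : ∀ {x₁ y₁ x₂ y₂ x₃ y₃} →
    InGrid m n x₁ y₁ → InGrid m n x₂ y₂ → InGrid m n x₃ y₃ → x₁ + x₂ ≡ x₃ → y₁ + y₂ ≡ y₃ →
    ¬ Distinct3 (c x₁ y₁) (c x₂ y₂) (c x₃ y₃)
  noRainbowSum {x₁} {y₁} {x₂} {y₂} g₁ g₂ g₃ refl refl d =
    noRainbow (x₁ , y₁ , x₂ , y₂ , g₁ , g₂ , g₃ , d)

  diagonalShift-sameColour : ∀ {x₁ y₁ x₂ y₂ t} → InGrid m n x₁ y₁ → InGrid m n x₂ y₂ →
    1 ≤ t → x₁ + t ≡ x₂ → y₁ + t ≡ y₂ →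
    OffDiagonal (c x₁ y₁) → OffDiagonal (c x₂ y₂) → c x₁ y₁ ≡ c x₂ y₂
  diagonalShift-sameColour {t = t} g₁ g₂@((_ , x₂≤m) , _) 1≤t ex ey o₁ o₂ =
    decidable-stable (_ ≟ _) λ ≢ →
      noRainbowSum g₁ (diagonal-inGrid 1≤t t≤m) g₂ ex ey
        (offDiagonal≢diagonal o₁ tt , ≢ , offDiagonal≢diagonal o₂ tt ∘ sym)
    where
    t≤m : t ≤ m
    t≤m = +-offset-≤ ex x₂≤m
    tt : InDiagImage m c (c t t)
    tt = diagonalColour 1≤t t≤m

  sameLine-sameColour : ∀ {x₁ y₁ x₂ y₂} → InGrid m n x₁ y₁ → InGrid m n x₂ y₂ →
    SameLine x₁ y₁ x₂ y₂ → OffDiagonal (c x₁ y₁) → OffDiagonal (c x₂ y₂) → c x₁ y₁ ≡ c x₂ y₂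
  sameLine-sameColour {x₁} {x₂ = x₂} g₁ g₂ l o₁ o₂ with <-cmp x₁ x₂
  ... | tri< x₁<x₂ _ _ with t , 1≤t , e ← m<n⇒∃[o]m+o≡n x₁<x₂ =
    diagonalShift-sameColour g₁ g₂ 1≤t e (sameLine-shift e l) o₁ o₂
  ... | tri≈ _ refl _ = cong (c x₁) (sym (+-cancelˡ-≡ x₁ _ _ l))
  ... | tri> _ _ x₂<x₁ with t , 1≤t , e ← m<n⇒∃[o]m+o≡n x₂<x₁ =
    sym (diagonalShift-sameColour g₂ g₁ 1≤t e (sameLine-shift e (sym l)) o₂ o₁)

  module _ (1≤m : 1 ≤ m)
    (onto : ∀ k → 1 ≤ k → k ≤ m + n + 1 → ∃[ i ] ∃[ j ] (InGrid m n i j × c i j ≡ k))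
    {a b d : ℕ} (diagonal-a : InDiagImage m c a) (diagonal-b : InDiagImage m c b)
    (diagonal-d : InDiagImage m c d) (cover : ∀ k → InDiagImage m c k → k ≡ a ⊎ k ≡ b ⊎ k ≡ d)
    where

    classify : ∀ k → k ≡ a ⊎ k ≡ b ⊎ k ≡ d ⊎ OffDiagonal k
    classify k with k ≟ a | k ≟ b | k ≟ d
    ... | yes e | _     | _     = inj₁ e
    ... | no _  | yes e | _     = inj₂ (inj₁ e)
    ... | no _  | no _  | yes e = inj₂ (inj₂ (inj₁ e))
    ... | no ≢a | no ≢b | no ≢d = inj₂ (inj₂ (inj₂ λ dk → [ ≢a , [ ≢b , ≢d ]′ ]′ (cover k dk)))

    OccursOffLine : ℕ → ℕ → ℕ → Set
    OccursOffLine k x y = ∃[ p ] ∃[ q ] (InGrid m n p q × c p q ≡ k × ¬ SameLine p q x y)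

    EveryOffDiagonalColourOccursOff : ℕ → ℕ → Set
    EveryOffDiagonalColourOccursOff x y =
      ∀ k → 1 ≤ k → k ≤ m + n + 1 → OffDiagonal k → OccursOffLine k x y

    module Counting {x y} (gxy : InGrid m n x y) (x≢y : x ≢ y)
      (avoid : EveryOffDiagonalColourOccursOff x y) where

      data Kind (k : ℕ) : Set where
        isA : k ≡ a → Kind k
        isB : k ≡ b → Kind k
        isD : k ≡ d → Kind k
        off : OffDiagonal k → OccursOffLine k x y → Kind k

      1≤n : 1 ≤ n
      1≤n = ≤-trans 1≤m m≤n

      n≢0 : n ≢ 0
      n≢0 n≡0 = <-irrefl (sym n≡0) 1≤n

      -- Representatives on pairwise different lines: the diagonal for a, the line of (x,y)
      -- for b, the point (0,n) off every grid line for d, and an occurrence off the line of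
      -- (x,y) for an off-diagonal colour.
      repX repY : ∀ {k} → Kind k → ℕ
      repX (isA _) = 0
      repX (isB _) = x
      repX (isD _) = 0
      repX (off _ (p , _)) = p
      repY (isA _) = 0
      repY (isB _) = y
      repY (isD _) = n
      repY (off _ (_ , q , _)) = q

      repY≤n : ∀ {k} (κ : Kind k) → repY κ ≤ n
      repY≤n (isA _) = z≤n
      repY≤n (isB _) = proj₂ (proj₂ gxy)
      repY≤n (isD _) = ≤-refl
      repY≤n (off _ (_ , _ , (_ , (_ , q≤n)) , _)) = q≤n

      slot : ∀ {k} → Kind k → ℕ
      slot κ = lineIndex n (repX κ) (repY κ)

      slot<m+n : ∀ {k} (κ : Kind k) → slot κ < m + n
      slot<m+n (isA _) = m<n+m n 1≤m
      slot<m+n (isB _) = lineIndex<m+n (proj₂ (proj₁ gxy)) (proj₁ (proj₂ gxy)) (proj₂ (proj₂ gxy))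
      slot<m+n (isD _) = lineIndex<m+n z≤n 1≤n ≤-refl
      slot<m+n (off _ (_ , _ , ((_ , p≤m) , (1≤q , q≤n)) , _)) = lineIndex<m+n p≤m 1≤q q≤n

      sameLine⇒sameColour : ∀ {k₁ k₂} (κ₁ : Kind k₁) (κ₂ : Kind k₂) →
        SameLine (repX κ₁) (repY κ₁) (repX κ₂) (repY κ₂) → k₁ ≡ k₂
      sameLine⇒sameColour (isA e₁) (isA e₂) _ = trans e₁ (sym e₂)
      sameLine⇒sameColour (isA _) (isB _) l = ⊥-elim (x≢y (sym (trans l (+-identityʳ x))))
      sameLine⇒sameColour (isA _) (isD _) l = ⊥-elim (n≢0 l)
      sameLine⇒sameColour (isA _) (off o (p , _ , g , e , _)) l =
        ⊥-elim (offDiagonal⇒≢ g (subst OffDiagonal (sym e) o) (sym (trans l (+-identityʳ p))))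
      sameLine⇒sameColour (isB _) (isA _) l = ⊥-elim (x≢y (trans (sym (+-identityʳ x)) l))
      sameLine⇒sameColour (isB e₁) (isB e₂) _ = trans e₁ (sym e₂)
      sameLine⇒sameColour (isB _) (isD _) l = ⊥-elim (¬sameLine-0n gxy (sym l))
      sameLine⇒sameColour (isB _) (off _ (_ , _ , _ , _ , ¬l)) l = ⊥-elim (¬l (sym l))
      sameLine⇒sameColour (isD _) (isA _) l = ⊥-elim (n≢0 (sym l))
      sameLine⇒sameColour (isD _) (isB _) l = ⊥-elim (¬sameLine-0n gxy l)
      sameLine⇒sameColour (isD e₁) (isD e₂) _ = trans e₁ (sym e₂)
      sameLine⇒sameColour (isD _) (off _ (_ , _ , g , _)) l = ⊥-elim (¬sameLine-0n g l)
      sameLine⇒sameColour (off o (p , _ , g , e , _)) (isA _) l =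
        ⊥-elim (offDiagonal⇒≢ g (subst OffDiagonal (sym e) o) (trans (sym (+-identityʳ p)) l))
      sameLine⇒sameColour (off _ (_ , _ , _ , _ , ¬l)) (isB _) l = ⊥-elim (¬l l)
      sameLine⇒sameColour (off _ (_ , _ , g , _)) (isD _) l = ⊥-elim (¬sameLine-0n g (sym l))
      sameLine⇒sameColour (off o₁ (_ , _ , g₁ , e₁ , _)) (off o₂ (_ , _ , g₂ , e₂ , _)) l =
        trans (sym e₁) (trans (sameLine-sameColour g₁ g₂ l
          (subst OffDiagonal (sym e₁) o₁) (subst OffDiagonal (sym e₂) o₂)) e₂)

      colourOf : Fin (m + n + 1) → ℕ
      colourOf f = suc (toℕ f)

      kindOf : (f : Fin (m + n + 1)) → Kind (colourOf f)
      kindOf f with classify (colourOf f)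
      ... | inj₁ e               = isA e
      ... | inj₂ (inj₁ e)        = isB e
      ... | inj₂ (inj₂ (inj₁ e)) = isD e
      ... | inj₂ (inj₂ (inj₂ o)) = off o (avoid (colourOf f) (s≤s z≤n) (toℕ<n f) o)

      impossible : ⊥
      impossible
        with f₁ , f₂ , f₁<f₂ , e ← pigeonhole (m<m+n (m + n) z<s) (λ f → fromℕ< (slot<m+n (kindOf f)))
        = <-irrefl (suc-injective (sameLine⇒sameColour (kindOf f₁) (kindOf f₂)
            (lineIndex-injective n (repY≤n (kindOf f₁)) (repY≤n (kindOf f₂))
              (fromℕ<-injective _ _ _ _ e))))
          f₁<f₂

    ¬everyOffDiagonalColourOccursOff : ∀ {x y} → InGrid m n x y → x ≢ y →
      ¬ EveryOffDiagonalColourOccursOff x y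
    ¬everyOffDiagonalColourOccursOff gxy x≢y avoid = Counting.impossible gxy x≢y avoid

    offDiagonalColourOnLine : ∀ {x y} → InGrid m n x y → x ≢ y →
      ¬ (∀ p q → InGrid m n p q → SameLine p q x y → ¬ OffDiagonal (c p q))
    offDiagonalColourOnLine gxy x≢y none = ¬everyOffDiagonalColourOccursOff gxy x≢y occursOff
      where
      occursOff : EveryOffDiagonalColourOccursOff _ _
      occursOff k 1≤k k≤N o with p , q , g , e ← onto k 1≤k k≤N =
        p , q , g , e , λ l → none p q g l (subst OffDiagonal (sym e) o)

    colourClass-sameLine : ∀ {x₁ y₁ x₂ y₂} → InGrid m n x₁ y₁ → InGrid m n x₂ y₂ →
      OffDiagonal (c x₁ y₁) → c x₁ y₁ ≡ c x₂ y₂ → SameLine x₁ y₁ x₂ y₂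
    colourClass-sameLine {x₁} {y₁} {x₂} {y₂} g₁ g₂ o₁ e = decidable-stable (_ ≟ _) λ ¬l →
      ¬everyOffDiagonalColourOccursOff g₂ (offDiagonal⇒≢ g₂ o₂) (occursOff ¬l)
      where
      o₂ : OffDiagonal (c x₂ y₂)
      o₂ = subst OffDiagonal e o₁
      occursOff : ¬ SameLine x₁ y₁ x₂ y₂ → EveryOffDiagonalColourOccursOff x₂ y₂
      occursOff ¬l k 1≤k k≤N o with k ≟ c x₂ y₂ | onto k 1≤k k≤N
      ... | yes refl | _ = x₁ , y₁ , g₁ , e , ¬l
      ... | no k≢ | p , q , g , e′ = p , q , g , e′ , λ l →
        k≢ (trans (sym e′) (sameLine-sameColour g g₂ l (subst OffDiagonal (sym e′) o) o₂))

    module _ {s : ℕ} (1≤s : 1 ≤ s) (s≤m : s ≤ m) (fresh : ∀ t → 1 ≤ t → t < s → c t t ≢ c s s) where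

      diagonal-s : InDiagImage m c (c s s)
      diagonal-s = diagonalColour 1≤s s≤m

      <s⇒≤m : ∀ {t} → t < s → t ≤ m
      <s⇒≤m t<s = <⇒≤ (<-≤-trans t<s s≤m)

      farAlongLine : ∀ {u w b₁ b₂} → InGrid m n u w → u ≤ s → c u w ≡ c s s →
        InGrid m n b₁ b₂ → OffDiagonal (c b₁ b₂) → SameLine b₁ b₂ u w →
        ∃[ v ] (u + (s + v) ≡ b₁ × w + (s + v) ≡ b₂)
      farAlongLine {u} {w} {b₁} gu u≤s C gb@((1≤b₁ , _) , _) o l with <-cmp b₁ u
      ... | tri< b₁<u _ _ with t , 1≤t , e ← m<n⇒∃[o]m+o≡n b₁<u = ⊥-elim
        (noRainbowSum gb (diagonal-inGrid 1≤t t≤m) gu e (sameLine-shift e l)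
          ( offDiagonal≢diagonal o (diagonalColour 1≤t t≤m)
          , (λ F≡C → offDiagonal≢diagonal o diagonal-s (trans F≡C C))
          , (λ ≡C → fresh t 1≤t t<s (trans ≡C C))))
        where
        t<s : t < s
        t<s = <-≤-trans (m<n+m t 1≤b₁) (≤-trans (≤-reflexive e) u≤s)
        t≤m : t ≤ m
        t≤m = <s⇒≤m t<s
      ... | tri≈ _ refl _ =
        ⊥-elim (offDiagonal≢diagonal o diagonal-s (trans (cong (c b₁) (sym (+-cancelˡ-≡ b₁ _ _ l))) C))
      ... | tri> _ _ u<b₁ with t , 1≤t , e ← m<n⇒∃[o]m+o≡n u<b₁ | t <? s
      ...   | yes t<s = ⊥-elim
        (noRainbowSum gu (diagonal-inGrid 1≤t (<s⇒≤m t<s)) gb e (sameLine-shift e (sym l))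
          ( (λ C≡ → fresh t 1≤t t<s (trans (sym C≡) C))
          , (λ C≡F → offDiagonal≢diagonal o diagonal-s (trans (sym C≡F) C))
          , offDiagonal≢diagonal o (diagonalColour 1≤t (<s⇒≤m t<s)) ∘ sym))
      ...   | no t≮s with v , ev ← m≤n⇒∃[o]m+o≡n (≮⇒≥ t≮s) =
        v , trans (cong (u +_) ev) e , trans (cong (w +_) ev) (sameLine-shift e (sym l))

      module MirrorImage {i j u w} (g : InGrid m n i j) (o : OffDiagonal (c i j))
        (1≤u : 1 ≤ u) (1≤w : 1 ≤ w) (eu : i + u ≡ s) (ew : j + w ≡ s) where

        i≢j : i ≢ j
        i≢j = offDiagonal⇒≢ g o

        eij : i + u ≡ j + w
        eij = trans eu (sym ew)

        u≢w : u ≢ w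
        u≢w refl = i≢j (+-cancelʳ-≡ u i j eij)

        guw : InGrid m n u w
        guw = inGrid-summand eu ew (diagonal-inGrid 1≤s s≤m) 1≤u 1≤w

        c[u,w] : c u w ≡ c i j ⊎ c u w ≡ c s s
        c[u,w] with c u w ≟ c i j | c u w ≟ c s s
        ... | yes e  | _      = inj₁ e
        ... | no _   | yes e  = inj₂ e
        ... | no ≢ij | no ≢ss = ⊥-elim (noRainbowSum g guw (diagonal-inGrid 1≤s s≤m) eu ew
                (≢ij ∘ sym , offDiagonal≢diagonal o diagonal-s , ≢ss))

        mirrorLine-colour≢ : ∀ {b₁ b₂} → InGrid m n b₁ b₂ → SameLine b₁ b₂ u w → c b₁ b₂ ≢ c i j
        mirrorLine-colour≢ {b₁} gb l F≡D = i≢j (reflection-sameLine⇒≡ {i} {j} {u} {w} eij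
          (sameLine-trans {i} {j} {b₁} (colourClass-sameLine g gb o (sym F≡D)) l))

        ¬farAlongMirrorLine : ∀ {b₁ b₂ v} → InGrid m n b₁ b₂ → OffDiagonal (c b₁ b₂) →
          c b₁ b₂ ≢ c i j → u + (s + v) ≡ b₁ → w + (s + v) ≡ b₂ → ⊥
        ¬farAlongMirrorLine {b₁} {b₂} {v} gb oF F≢D e₁ e₂ =
          noRainbowSum g gr gb er₁ er₂ (D≢R , F≢D ∘ sym , R≢F)
          where
          er₁ : i + (u + u + v) ≡ b₁
          er₁ = doubledReflection {i} {u} {v} eu e₁
          er₂ : j + (w + w + v) ≡ b₂
          er₂ = doubledReflection {j} {w} {v} ew e₂
          gr : InGrid m n (u + u + v) (w + w + v)
          gr = inGrid-summand {x = i} {y = j} er₁ er₂ gb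
            (≤-trans 1≤u (≤-trans (m≤m+n u u) (m≤m+n (u + u) v)))
            (≤-trans 1≤w (≤-trans (m≤m+n w w) (m≤m+n (w + w) v)))
          D≢R : c i j ≢ c (u + u + v) (w + w + v)
          D≢R e = i≢j (reflection-sameLine-double⇒≡ {i} {j} {u} {w} {v} eij
            (colourClass-sameLine g gr o e))
          R≢F : c (u + u + v) (w + w + v) ≢ c b₁ b₂
          R≢F e = i≢j (sameLine-+⇒≡ {i} {j} er₁ er₂ (colourClass-sameLine gb gr oF (sym e)))

        ¬offDiagonalOnMirrorLine : ∀ b₁ b₂ → InGrid m n b₁ b₂ → SameLine b₁ b₂ u w →
          ¬ OffDiagonal (c b₁ b₂)
        ¬offDiagonalOnMirrorLine b₁ b₂ gb l oF = [ viaD , viaC ]′ c[u,w]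
          where
          viaD : c u w ≡ c i j → ⊥
          viaD e = mirrorLine-colour≢ gb l
            (trans (sameLine-sameColour gb guw l oF (subst OffDiagonal (sym e) o)) e)
          viaC : c u w ≡ c s s → ⊥
          viaC C with v , e₁ , e₂ ← farAlongLine guw (+-offset-≤ eu ≤-refl) C gb oF l =
            ¬farAlongMirrorLine gb oF (mirrorLine-colour≢ gb l) e₁ e₂

      ¬offDiagonal-belowFresh : ∀ {i j} → InGrid m n i j → i < s → j < s → ¬ OffDiagonal (c i j)
      ¬offDiagonal-belowFresh g i<s j<s o
        with u , 1≤u , eu ← m<n⇒∃[o]m+o≡n i<s | w , 1≤w , ew ← m<n⇒∃[o]m+o≡n j<s =
        offDiagonalColourOnLine guw u≢w ¬offDiagonalOnMirrorLine
        where open MirrorImage g o 1≤u 1≤w eu ew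

      belowFresh⇒diagonalColour : ∀ {i j} → InGrid m n i j → i < s → j < s → InDiagImage m c (c i j)
      belowFresh⇒diagonalColour {i} {j} g i<s j<s with classify (c i j)
      ... | inj₁ e               = subst (InDiagImage m c) (sym e) diagonal-a
      ... | inj₂ (inj₁ e)        = subst (InDiagImage m c) (sym e) diagonal-b
      ... | inj₂ (inj₂ (inj₁ e)) = subst (InDiagImage m c) (sym e) diagonal-d
      ... | inj₂ (inj₂ (inj₂ o)) = ⊥-elim (¬offDiagonal-belowFresh g i<s j<s o)

s₃-fresh : ∀ {m c s₂ s₃} → IsS3 m c s₂ s₃ → ∀ t → 1 ≤ t → t < s₃ → c t t ≢ c s₃ s₃
s₃-fresh (_ , ≢c₁₁ , ≢c₂₂ , below) t 1≤t t<s₃ c₃₃≡ =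
  [ ≢c₁₁ ∘ trans (sym c₃₃≡) , ≢c₂₂ ∘ trans (sym c₃₃≡) ]′ (below t 1≤t t<s₃)

lemma3p3 : (m n : ℕ) → 3 ≤ m → m ≤ n → (c : Coloring) →
    IsExactColoring m n (m + n + 1) c →
    ¬ RainbowSolution m n c →
    DiagImageSize3 m c →
    (s₂ s₃ : ℕ) → IsS2 m c s₂ → IsS3 m c s₂ s₃ →
    (i j : ℕ) → InGrid m n i j → i < s₃ → j < s₃ →
    InDiagImage m c (c i j)
lemma3p3 m n 3≤m m≤n c (_ , onto) noRainbow (_ , _ , _ , _ , da , db , dd , cover)
  s₂ s₃ _ s₃-spec@((1≤s₃ , s₃≤m) , _) i j g i<s₃ j<s₃ =
  belowFresh⇒diagonalColour m≤n noRainbow (≤-trans (s≤s z≤n) 3≤m) onto da db dd cover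
    1≤s₃ s₃≤m (s₃-fresh {m} {c} {s₂} s₃-spec) g i<s₃ j<s₃
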